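{- Let $n\ge 2$. Let $\mathbf L_{n-1}$ be a set containing exactly one representative from each LC orbit of connected simple undirected graphs on $n-1$ vertices. Let $\mathbf E_n$ be the set of all graphs obtained from some graph in $\mathbf L_{n-1}$ by adding one new vertex and joining it by edges to a nonempty subset of the old vertices (all $2^{n-1}-1$ such extensions of each graph). Then for every connected simple undirected graph $G$ on $n$ vertices, the LC orbit of $G$ contains a graph isomorphic to a member of $\mathbf E_n$; i.e. $\mathbf E_n$ contains at least one representative of each LC orbit of connected graphs on $n$ vertices.
   Context: Local complementation (LC) at a vertex $v$ of a graph $G$ replaces the induced subgraph on the neighbourhood $N_v$ of $v$ by its complement. The LC orbit of a graph $G$ is the set of all unlabeled graphs (graphs up to isomorphism) obtainable from $G$ by any finite sequence of local complementations. -}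

module Defs where

open import Data.Nat using (ℕ; zero; suc)
open import Data.Fin using (Fin; zero; suc)
open import Data.Fin.Properties using (_≟_)
open import Data.Fin.Permutation using (Permutation′; _⟨$⟩ʳ_)
open import Data.Bool using (Bool; true; false; not; _∧_; if_then_else_)
open import Data.List using (List; []; _∷_)
open import Data.Product using (Σ; ∃; ∃-syntax; _×_; _,_)
open import Relation.Nullary using (¬_; does)
open import Relation.Binary.PropositionalEquality using (_≡_)

Graph : ℕ → Set
Graph n = Fin n → Fin n → Bool

record Simple {n : ℕ} (G : Graph n) : Set where
  field
    symmetric   : ∀ x y → G x y ≡ G y x
    irreflexive : ∀ x → G x x ≡ false

data Reach {n : ℕ} (G : Graph n) : Fin n → Fin n → Set where
  here : ∀ {x} → Reach G x x
  step : ∀ {x y z} → G x y ≡ true → Reach G y z → Reach G x z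

Connected : {n : ℕ} → Graph n → Set
Connected G = ∀ x y → Reach G x y

LC : {n : ℕ} → Fin n → Graph n → Graph n
LC v G x y =
  if G v x ∧ G v y ∧ not (does (x ≟ y)) then not (G x y) else G x y

LCs : {n : ℕ} → List (Fin n) → Graph n → Graph n
LCs []       G = G
LCs (v ∷ vs) G = LCs vs (LC v G)

_≅_ : {n : ℕ} → Graph n → Graph n → Set
_≅_ {n} G H = Σ (Permutation′ n) λ σ →
  ∀ x y → G x y ≡ H (σ ⟨$⟩ʳ x) (σ ⟨$⟩ʳ y)

InLCOrbit : {n : ℕ} → Graph n → Graph n → Set
InLCOrbit G H = ∃[ vs ] (LCs vs G ≅ H)

record LCOrbitRepresentatives (n : ℕ) (L : Graph n → Set) : Set₁ where
  field
    members-simple    : ∀ H → L H → Simple H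
    members-connected : ∀ H → L H → Connected H
    covers   : ∀ G → Simple G → Connected G → ∃[ H ] (L H × InLCOrbit G H)
    distinct : ∀ H H′ → L H → L H′ → InLCOrbit H H′ → H ≡ H′

extend : {m : ℕ} → Graph m → (Fin m → Bool) → Graph (suc m)
extend G S zero    zero    = false
extend G S zero    (suc y) = S y
extend G S (suc x) zero    = S x
extend G S (suc x) (suc y) = G x y

NonemptySubset : {m : ℕ} → (Fin m → Bool) → Set
NonemptySubset S = ∃[ x ] (S x ≡ true)

E : {m : ℕ} → (Graph m → Set) → Graph (suc m) → Set
E {m} L G = ∃[ H ] ∃[ S ] (L H × NonemptySubset S × G ≡ extend H S)

{-# OPTIONS --safe #-}
-- A connected graph on at least two vertices has a non-separating vertex v
-- (grow a connected vertex set one neighbour at a time; the last vertex added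
-- is one). Choose local complementations taking G - v to its representative H.
-- Local complementations at vertices other than v commute with deleting v, so
-- performing them in G gives a graph G″ with G″ - v ≅ H; and they never
-- isolate v. Hence G″ is isomorphic to the extension of H by the (nonempty)
-- neighbourhood of v.
module Submission where

open import Defs
open import Data.Nat using (ℕ; suc; _≤_; s≤s; z≤n)
open import Data.Product using (∃-syntax; _×_; _,_; proj₁; proj₂)
open import Data.Bool using (Bool; true; false; not)
open import Data.Bool.Properties using (∧-zeroʳ; ∧-commutativeMonoid)
open import Data.Fin using (Fin; zero; suc; punchIn; punchOut)
open import Data.Fin.Properties
  using (_≟_; punchIn-injective; punchInᵢ≢i; punchIn-punchOut; all?; ¬∀⟶∃¬)
open import Data.Fin.Permutation
  using (Permutation′; _⟨$⟩ʳ_; _⟨$⟩ˡ_; id; flip; _∘ₚ_; insert; lift₀; inverseˡ; inverseʳ)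
open import Data.Fin.Subset using (Subset; _∈_; _∉_; _∪_; ⁅_⁆; _⊆_; _⊂_; _⊃_)
open import Data.Fin.Subset.Properties
  using (_∈?_; x∈⁅x⁆; x∈⁅y⁆⇒x≡y; x≢y⇒x∉⁅y⁆; x∈p∪q⁻; p⊆p∪q; q⊆p∪q)
open import Data.Fin.Subset.Induction using (Acc; acc; ⊃-wellFounded)
open import Data.List using (List; []; _∷_; map)
open import Data.Sum using (inj₁; inj₂)
open import Function using (_∘_; mk⇔)
open import Relation.Nullary using (does; yes; no; contradiction)
open import Relation.Nullary.Decidable using (dec-true; does-⇔)
open import Relation.Binary.PropositionalEquality
open import Algebra.Bundles using (CommutativeMonoid)
open import Algebra.Properties.CommutativeSemigroup
  (CommutativeMonoid.commutativeSemigroup ∧-commutativeMonoid) using (x∙yz≈y∙xz)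

private
  variable
    n : ℕ

infix 4 _≐_

_≐_ : Graph n → Graph n → Set
G ≐ H = ∀ x y → G x y ≡ H x y

LC-diagonal : ∀ (w : Fin n) G x → LC w G x x ≡ G x x
LC-diagonal w G x
  rewrite dec-true (x ≟ x) refl | ∧-zeroʳ (G w x) | ∧-zeroʳ (G w x) = refl

LC-symmetric : ∀ (w : Fin n) G → (∀ x y → G x y ≡ G y x) →
               ∀ x y → LC w G x y ≡ LC w G y x
LC-symmetric w G sym-G x y
  rewrite sym-G x y
        | does-⇔ (mk⇔ sym sym) (x ≟ y) (y ≟ x)
        | x∙yz≈y∙xz (G w x) (G w y) (not (does (y ≟ x))) = refl

LC-simple : ∀ (w : Fin n) G → Simple G → Simple (LC w G)
LC-simple w G simple = record
  { symmetric   = LC-symmetric w G symmetric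
  ; irreflexive = λ x → trans (LC-diagonal w G x) (irreflexive x)
  }
  where open Simple simple

LCs-simple : ∀ (vs : List (Fin n)) G → Simple G → Simple (LCs vs G)
LCs-simple []       G simple = simple
LCs-simple (v ∷ vs) G simple = LCs-simple vs (LC v G) (LC-simple v G simple)

LC-cong : ∀ (w : Fin n) {G H} → G ≐ H → LC w G ≐ LC w H
LC-cong w G≐H x y rewrite G≐H w x | G≐H w y | G≐H x y = refl

LCs-cong : ∀ (vs : List (Fin n)) {G H} → G ≐ H → LCs vs G ≐ LCs vs H
LCs-cong []       G≐H = G≐H
LCs-cong (v ∷ vs) G≐H = LCs-cong vs (LC-cong v G≐H)

LC-pivot-column : ∀ (w : Fin n) G → G w w ≡ false → ∀ x → LC w G x w ≡ G x w
LC-pivot-column w G ww x rewrite ww | ∧-zeroʳ (G w x) = refl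

LC-non-neighbour-row : ∀ (w : Fin n) G {v} → G w v ≡ false → ∀ y → LC w G v y ≡ G v y
LC-non-neighbour-row w G wv y rewrite wv = refl

LC-nonisolated : ∀ (w v : Fin n) G → Simple G →
                 NonemptySubset (G v) → NonemptySubset (LC w G v)
LC-nonisolated w v G simple (u , vu) = by-adjacency (G w v) refl
  where
  open Simple simple
  by-adjacency : ∀ b → G w v ≡ b → NonemptySubset (LC w G v)
  by-adjacency false wv = u , trans (LC-non-neighbour-row w G wv u) vu
  by-adjacency true  wv =
    w , trans (LC-pivot-column w G (irreflexive w) v) (trans (symmetric v w) wv)

LCs-nonisolated : ∀ vs (v : Fin n) G → Simple G →
                  NonemptySubset (G v) → NonemptySubset (LCs vs G v)
LCs-nonisolated []       v G simple v-nonisolated = v-nonisolated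
LCs-nonisolated (w ∷ vs) v G simple v-nonisolated =
  LCs-nonisolated vs v (LC w G) (LC-simple w G simple)
    (LC-nonisolated w v G simple v-nonisolated)

delete : Fin (suc n) → Graph (suc n) → Graph n
delete v G x y = G (punchIn v x) (punchIn v y)

delete-simple : ∀ (v : Fin (suc n)) G → Simple G → Simple (delete v G)
delete-simple v G simple = record
  { symmetric   = λ x y → symmetric (punchIn v x) (punchIn v y)
  ; irreflexive = λ x → irreflexive (punchIn v x)
  }
  where open Simple simple

delete-LC : ∀ (v : Fin (suc n)) w G →
            delete v (LC (punchIn v w) G) ≐ LC w (delete v G)
delete-LC v w G x y
  rewrite does-⇔ (mk⇔ (punchIn-injective v x y) (cong (punchIn v)))
                 (punchIn v x ≟ punchIn v y) (x ≟ y) = refl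

delete-LCs : ∀ (v : Fin (suc n)) vs G →
             delete v (LCs (map (punchIn v) vs) G) ≐ LCs vs (delete v G)
delete-LCs v []       G x y = refl
delete-LCs v (w ∷ vs) G x y =
  trans (delete-LCs v vs (LC (punchIn v w) G) x y)
        (LCs-cong vs (delete-LC v w G) x y)

reach⇒nonisolated : ∀ {G : Graph n} {x y} → Reach G x y → x ≢ y → NonemptySubset (G x)
reach⇒nonisolated here              x≢x = contradiction refl x≢x
reach⇒nonisolated (step {y = u} xu _) _ = u , xu

nonisolated-delete : ∀ (v : Fin (suc n)) G → Simple G →
                     NonemptySubset (G v) → NonemptySubset (G v ∘ punchIn v)
nonisolated-delete v G simple (u , vu) with v ≟ u
... | yes refl = contradiction (trans (sym vu) (Simple.irreflexive simple v)) λ ()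
... | no  v≢u  = punchOut v≢u , trans (cong (G v) (punchIn-punchOut v≢u)) vu

≅-sym : {G H : Graph n} → G ≅ H → H ≅ G
≅-sym {H = H} (σ , G≅H) = flip σ , λ x y →
  trans (cong₂ H (sym (inverseʳ σ)) (sym (inverseʳ σ))) (sym (G≅H _ _))

≅-trans : {G H K : Graph n} → G ≅ H → H ≅ K → G ≅ K
≅-trans (σ , G≅H) (τ , H≅K) = σ ∘ₚ τ , λ x y → trans (G≅H x y) (H≅K _ _)

≐-≅-trans : {G H K : Graph n} → G ≐ H → H ≅ K → G ≅ K
≐-≅-trans G≐H (σ , H≅K) = σ , λ x y → trans (G≐H x y) (H≅K x y)

nonempty-∘-permutation : ∀ (σ : Permutation′ n) {S : Fin n → Bool} →
                         NonemptySubset S → NonemptySubset (S ∘ (σ ⟨$⟩ˡ_))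
nonempty-∘-permutation σ {S} (x , Sx) = σ ⟨$⟩ʳ x , trans (cong S (inverseˡ σ)) Sx

extend-≅ : ∀ {G H : Graph n} S → ((σ , _) : G ≅ H) →
           extend G S ≅ extend H (S ∘ (σ ⟨$⟩ˡ_))
extend-≅ {G = G} S (σ , G≅H) = lift₀ σ , iso
  where
  iso : ∀ x y → extend G S x y ≡ _
  iso zero    zero    = refl
  iso zero    (suc y) = cong S (sym (inverseˡ σ))
  iso (suc x) zero    = cong S (sym (inverseˡ σ))
  iso (suc x) (suc y) = G≅H x y

extend-delete-≅ : ∀ (v : Fin (suc n)) G → Simple G →
                  extend (delete v G) (G v ∘ punchIn v) ≅ G
extend-delete-≅ v G simple = insert zero v id , iso
  where
  open Simple simple
  iso : ∀ x y → extend (delete v G) (G v ∘ punchIn v) x y ≡ _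
  iso zero    zero    = sym (irreflexive v)
  iso zero    (suc y) = refl
  iso (suc x) zero    = symmetric v (punchIn v x)
  iso (suc x) (suc y) = refl

module _ (G : Graph n) where

  data WalkIn (p : Subset n) : Fin n → Fin n → Set where
    here : ∀ {x} → x ∈ p → WalkIn p x x
    step : ∀ {x y z} → x ∈ p → G x y ≡ true → WalkIn p y z → WalkIn p x z

  InducedConnected : Subset n → Set
  InducedConnected p = ∀ {x y} → x ∈ p → y ∈ p → WalkIn p x y

  WalkIn-head : ∀ {p x y} → WalkIn p x y → x ∈ p
  WalkIn-head (here x∈p)     = x∈p
  WalkIn-head (step x∈p _ _) = x∈p

  WalkIn-mono : ∀ {p q x y} → p ⊆ q → WalkIn p x y → WalkIn q x y
  WalkIn-mono p⊆q (here x∈p)        = here (p⊆q x∈p)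
  WalkIn-mono p⊆q (step x∈p xy walk) = step (p⊆q x∈p) xy (WalkIn-mono p⊆q walk)

  WalkIn-trans : ∀ {p x y z} → WalkIn p x y → WalkIn p y z → WalkIn p x z
  WalkIn-trans (here _)           walk′ = walk′
  WalkIn-trans (step x∈p xy walk) walk′ = step x∈p xy (WalkIn-trans walk walk′)

  InducedConnected-⁅⁆ : ∀ x → InducedConnected ⁅ x ⁆
  InducedConnected-⁅⁆ x y∈ z∈
    rewrite x∈⁅y⁆⇒x≡y x y∈ | x∈⁅y⁆⇒x≡y x z∈ = here (x∈⁅x⁆ x)

  InducedConnected-∪⁅⁆ : (∀ x y → G x y ≡ G y x) → ∀ {p w u} → InducedConnected p →
                         w ∈ p → G w u ≡ true → InducedConnected (p ∪ ⁅ u ⁆)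
  InducedConnected-∪⁅⁆ sym-G {p} {w} {u} connected w∈p wu x∈ y∈ =
    WalkIn-trans (to-w x∈) (from-w y∈)
    where
    grown : Subset n
    grown = p ∪ ⁅ u ⁆
    w∈ : w ∈ grown
    w∈ = p⊆p∪q ⁅ u ⁆ w∈p
    u∈ : u ∈ grown
    u∈ = q⊆p∪q p ⁅ u ⁆ (x∈⁅x⁆ u)
    to-w : ∀ {x} → x ∈ grown → WalkIn grown x w
    to-w x∈ with x∈p∪q⁻ p ⁅ u ⁆ x∈
    ... | inj₁ x∈p = WalkIn-mono (p⊆p∪q ⁅ u ⁆) (connected x∈p w∈p)
    ... | inj₂ x∈u rewrite x∈⁅y⁆⇒x≡y u x∈u = step u∈ (trans (sym-G u w) wu) (here w∈)
    from-w : ∀ {y} → y ∈ grown → WalkIn grown w y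
    from-w y∈ with x∈p∪q⁻ p ⁅ u ⁆ y∈
    ... | inj₁ y∈p = WalkIn-mono (p⊆p∪q ⁅ u ⁆) (connected w∈p y∈p)
    ... | inj₂ y∈u rewrite x∈⁅y⁆⇒x≡y u y∈u = step w∈ wu (here u∈)

  crossing-edge : ∀ p {x y} → Reach G x y → x ∈ p → y ∉ p →
                  ∃[ w ] ∃[ u ] (w ∈ p × u ∉ p × G w u ≡ true)
  crossing-edge p here x∈p y∉p = contradiction x∈p y∉p
  crossing-edge p {x} (step {y = x′} xx′ walk) x∈p y∉p with x′ ∈? p
  ... | yes x′∈p = crossing-edge p walk x′∈p y∉p
  ... | no  x′∉p = x , x′ , x∈p , x′∉p , xx′

module _ {G : Graph (suc n)} {v : Fin (suc n)} {p : Subset (suc n)} (v∉p : v ∉ p) where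

  WalkIn⇒Reach-delete : ∀ {a b} → WalkIn G p a b →
                        ∀ x y → punchIn v x ≡ a → punchIn v y ≡ b → Reach (delete v G) x y
  WalkIn⇒Reach-delete (here _) x y refl vy≡vx
    rewrite punchIn-injective v y x vy≡vx = here
  WalkIn⇒Reach-delete (step {y = c} _ xc walk) x y refl refl =
    step (trans (cong (G (punchIn v x)) (punchIn-punchOut v≢c)) xc)
         (WalkIn⇒Reach-delete walk (punchOut v≢c) y (punchIn-punchOut v≢c) refl)
    where
    v≢c : v ≢ c
    v≢c refl = v∉p (WalkIn-head G walk)

  InducedConnected⇒Connected-delete : InducedConnected G p →
    (∀ {z} → z ≢ v → z ∈ p) → Connected (delete v G)
  InducedConnected⇒Connected-delete connected p-covers x y =
    WalkIn⇒Reach-delete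
      (connected (p-covers (punchInᵢ≢i v x)) (p-covers (punchInᵢ≢i v y)))
      x y refl refl

-- Grow p by a neighbour u outside it; once p ∪ {u} is everything, u does not
-- separate.
grow-nonseparating : ∀ (G : Graph (suc n)) → Simple G → Connected G →
  ∀ p → Acc _⊃_ p → ∀ {r y} → r ∈ p → y ∉ p → InducedConnected G p →
  ∃[ v ] Connected (delete v G)
grow-nonseparating G simple connected p (acc rec) {r} {y} r∈p y∉p p-connected
  with crossing-edge G p (connected r y) r∈p y∉p
... | w , u , w∈p , u∉p , wu with all? (_∈? (p ∪ ⁅ u ⁆))
...   | yes p∪u-covers = u , InducedConnected⇒Connected-delete u∉p p-connected p-covers
  where
  p-covers : ∀ {z} → z ≢ u → z ∈ p
  p-covers {z} z≢u with x∈p∪q⁻ p ⁅ u ⁆ (p∪u-covers z)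
  ... | inj₁ z∈p = z∈p
  ... | inj₂ z∈u = contradiction z∈u (x≢y⇒x∉⁅y⁆ z≢u)
...   | no ¬p∪u-covers =
  grow-nonseparating G simple connected (p ∪ ⁅ u ⁆) (rec p⊂p∪u)
    (p⊆p∪q ⁅ u ⁆ r∈p) (proj₂ missing)
    (InducedConnected-∪⁅⁆ G (Simple.symmetric simple) p-connected w∈p wu)
  where
  p⊂p∪u : p ⊂ p ∪ ⁅ u ⁆
  p⊂p∪u = p⊆p∪q ⁅ u ⁆ , u , q⊆p∪q p ⁅ u ⁆ (x∈⁅x⁆ u) , u∉p
  missing : ∃[ y′ ] y′ ∉ p ∪ ⁅ u ⁆
  missing = ¬∀⟶∃¬ _ _ (_∈? (p ∪ ⁅ u ⁆)) ¬p∪u-covers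

nonseparating-vertex : ∀ (G : Graph (suc (suc n))) → Simple G → Connected G →
                       ∃[ v ] Connected (delete v G)
nonseparating-vertex G simple connected =
  grow-nonseparating G simple connected ⁅ zero ⁆ (⊃-wellFounded _) (x∈⁅x⁆ zero)
    (x≢y⇒x∉⁅y⁆ {x = suc zero} {y = zero} (λ ())) (InducedConnected-⁅⁆ G zero)

theorem14 : (m : ℕ) → 1 ≤ m → (L : Graph m → Set) →
    LCOrbitRepresentatives m L →
    ∀ (G : Graph (suc m)) → Simple G → Connected G →
    ∃[ G′ ] (E L G′ × InLCOrbit G G′)
theorem14 (suc m) (s≤s z≤n) L reps G simple connected
  with v , connected-v ← nonseparating-vertex G simple connected
  with H , H∈L , vs , G-v≅H ← LCOrbitRepresentatives.covers reps (delete v G)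
                                (delete-simple v G simple) connected-v
  = extend H S , (H , S , H∈L , S-nonempty , refl) , vs′ , G″≅extend
  where
  vs′ : List (Fin (suc (suc m)))
  vs′ = map (punchIn v) vs
  G″ : Graph (suc (suc m))
  G″ = LCs vs′ G
  simple″ : Simple G″
  simple″ = LCs-simple vs′ G simple
  σ : Permutation′ (suc m)
  σ = proj₁ G-v≅H
  S : Fin (suc m) → Bool
  S = G″ v ∘ punchIn v ∘ (σ ⟨$⟩ˡ_)
  S-nonempty : NonemptySubset S
  S-nonempty = nonempty-∘-permutation σ (nonisolated-delete v G″ simple″
    (LCs-nonisolated vs′ v G simple
      (reach⇒nonisolated (connected v (punchIn v zero)) (punchInᵢ≢i v zero ∘ sym))))
  G″-v≅H : delete v G″ ≅ H
  G″-v≅H = ≐-≅-trans {H = LCs vs (delete v G)} {K = H} (delete-LCs v vs G) G-v≅H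
  G″≅extend : G″ ≅ extend H S
  G″≅extend = ≅-trans {K = extend H S} (≅-sym (extend-delete-≅ v G″ simple″))
                      (extend-≅ {G = delete v G″} {H} (G″ v ∘ punchIn v) G″-v≅H)
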